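{- Let $\mathcal V=(d,Q,\Delta)$ be a VASS and let $s(\mathbf v)$ and $t(\mathbf w)$ be configurations ($\mathbf v,\mathbf w\in\mathbb N^d$). Then there exists $\mathbf w''\ge\mathbf w$ such that $t(\mathbf w'')$ is reachable from $s(\mathbf v)$ under monus semantics if and only if there exist a permutation $\sigma$ of $\{1,\ldots,d\}$ and $\mathbb Z$-configurations $p_d(\mathbf v_d),\ldots,p_1(\mathbf v_1),t(\mathbf w')$ (with $\mathbf v_i,\mathbf w'\in\mathbb Z^d$) such that (1) $s(\mathbf v)\to_{\mathbb Z}^* p_d(\mathbf v_d)\to_{\mathbb Z}^* p_{d-1}(\mathbf v_{d-1})\to_{\mathbb Z}^*\cdots\to_{\mathbb Z}^* p_1(\mathbf v_1)\to_{\mathbb Z}^* t(\mathbf w')$, and (2) for each $j\in\{1,\ldots,d\}$, $\mathbf w'[j]+\bigl|\min(\mathbf v_{\sigma^{ -1}(j)}[j],0)\bigr|\ge\mathbf w[j]$.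
   Context: A VASS is a triple $\mathcal V=(d,Q,\Delta)$ with $Q$ finite and $\Delta\subseteq Q\times\mathbb Z^d\times Q$ finite. Monus semantics: configurations $p(\mathbf u)$ with $\mathbf u\in\mathbb N^d$; a transition $(p,\mathbf z,q)$ takes $p(\mathbf u)$ to $q(\max(\mathbf u+\mathbf z,\mathbf 0))$ (componentwise). $\mathbb Z$-semantics: configurations $p(\mathbf u)$ with $\mathbf u\in\mathbb Z^d$; a transition $(p,\mathbf z,q)$ takes $p(\mathbf u)$ to $q(\mathbf u+\mathbf z)$ with no restriction. $\to_{\mathbb Z}^*$ denotes reachability (finitely many steps, possibly zero) in $\mathbb Z$-semantics. Vector order $\ge$ is componentwise. -}

module Defs where

open import Data.Nat using (ℕ; zero; suc)
open import Data.Integer using (ℤ; +_; _+_; _⊔_; ∣_∣; 0ℤ)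
open import Data.Fin using (Fin; fromℕ; inject₁)
open import Data.List using (List)
open import Data.List.Membership.Propositional using (_∈_)
open import Data.Product using (_×_; _,_; ∃)
open import Function using (_∘_)
open import Relation.Binary.Construct.Closure.ReflexiveTransitive using (Star)

record VASS (d : ℕ) : Set where
  field
    states : ℕ
    Δ      : List (Fin states × (Fin d → ℤ) × Fin states)

open VASS public

NConf : ∀ {d} → VASS d → Set
NConf {d} V = Fin (states V) × (Fin d → ℕ)

ZConf : ∀ {d} → VASS d → Set
ZConf {d} V = Fin (states V) × (Fin d → ℤ)

monus : ℕ → ℤ → ℕ
monus u z = ∣ (+ u + z) ⊔ 0ℤ ∣

data MStep {d} (V : VASS d) : NConf V → NConf V → Set where
  mstep : ∀ {p z q} (u : Fin d → ℕ) → (p , z , q) ∈ Δ V →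
          MStep V (p , u) (q , λ i → monus (u i) (z i))

data ZStep {d} (V : VASS d) : ZConf V → ZConf V → Set where
  zstep : ∀ {p z q} (u : Fin d → ℤ) → (p , z , q) ∈ Δ V →
          ZStep V (p , u) (q , λ i → u i + z i)

_⊢_→M*_ : ∀ {d} (V : VASS d) → NConf V → NConf V → Set
V ⊢ c →M* c' = Star (MStep V) c c'

_⊢_→Z*_ : ∀ {d} (V : VASS d) → ZConf V → ZConf V → Set
V ⊢ c →Z* c' = Star (ZStep V) c c'

-- ZChain V s n c t : s →Z* c(n-1) →Z* c(n-2) →Z* ... →Z* c(0) →Z* t
-- (c k plays the role of p_{k+1}(v_{k+1}) in the paper; for n = 0 it is s →Z* t)
ZChain : ∀ {d} (V : VASS d) → ZConf V → (n : ℕ) → (Fin n → ZConf V) → ZConf V → Set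
ZChain V s zero    c t = V ⊢ s →Z* t
ZChain V s (suc n) c t = (V ⊢ s →Z* c (fromℕ n)) × ZChain V (c (fromℕ n)) n (c ∘ inject₁) t

toℤ : ∀ {d} → (Fin d → ℕ) → (Fin d → ℤ)
toℤ u i = + u i

{-# OPTIONS --safe #-}
-- Run the monus semantics and the ℤ-semantics along the same transitions.
-- By induction, the monus counters always exceed the ℤ-counters by
-- D[j] = max over the configurations visited so far of |min(u[j], 0)|, since
-- max(y + z + D, 0) = (y + z) + max(D, |min(y + z, 0)|).  So t(w'') with
-- w'' ≥ w is monus-reachable iff some ℤ-run reaches t(w') with
-- w'[j] + D[j] ≥ w[j].  For each j pick a configuration of the run where
-- D[j] is attained; listing these d configurations in the order in which the
-- run visits them gives the chain of condition (1), and the permutation σ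
-- records that order.
module Submission where

open import Defs
open import Data.Nat using (ℕ)
open import Data.Integer using (ℤ; +_; _+_; _⊓_; _≥_; ∣_∣; 0ℤ)
open import Data.Fin using (Fin)
open import Data.Fin.Permutation using (Permutation′; _⟨$⟩ˡ_)
open import Data.Product using (Σ; ∃; _×_; _,_; proj₂)
open import Function.Bundles using (_⇔_)

import Data.Nat as ℕ
open Data.Nat using (zero; suc; z≤n; s≤s)
import Data.Nat.Properties as ℕₚ
import Data.Integer as ℤ
open Data.Integer using (-[1+_])
import Data.Integer.Properties as ℤₚ
open import Algebra.Properties.CommutativeSemigroup ℤₚ.+-commutativeSemigroup using (xy∙z≈xz∙y)
open import Data.Fin using (zero; suc; fromℕ; inject₁; punchIn; punchOut; _≟_)
open import Data.Fin.Properties using (punchIn-punchOut)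
open import Data.Fin.Relation.Unary.Top using (View; view; ‵fromℕ; ‵inj₁)
open import Data.Fin.Permutation using (Permutation; _⟨$⟩ʳ_; insert; flip; insert-punchIn)
import Data.Fin.Permutation as Perm
open import Data.Vec.Functional using (insertAt)
open import Data.Vec.Functional.Properties using (insertAt-lookup; insertAt-punchIn)
open import Data.List using (allFin)
open import Data.List.Extrema ℕₚ.≤-totalOrder using (argmin; f[argmin]≤f[xs])
open import Data.List.Membership.Propositional.Properties using (∈-allFin)
import Data.List.Relation.Unary.All as All
open import Data.Product using (proj₁)
open import Data.Sum using (_⊎_; inj₁; inj₂)
open import Relation.Nullary using (Dec; yes; no; contradiction)
open import Relation.Binary.PropositionalEquality
open import Relation.Binary.Construct.Closure.ReflexiveTransitive using (Star; ε; _◅_; _◅◅_)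
open import Function using (_∘_; mk⇔)

module _ {A : Set} {R : A → A → Set} where

  node : ∀ {a b} → Star R a b → ℕ → A
  node {a} _       zero    = a
  node {a} ε       (suc k) = a
  node     (_ ◅ ρ) (suc k) = node ρ k

  Visits : ∀ {a b} → Star R a b → A → Set
  Visits ρ x = ∃ λ k → node ρ k ≡ x

  ◅◅-visitsʳ : ∀ {a b e x} (ρ : Star R a b) {τ : Star R b e} → Visits τ x → Visits (ρ ◅◅ τ) x
  ◅◅-visitsʳ ε       v = v
  ◅◅-visitsʳ (_ ◅ ρ) v = let k , eq = ◅◅-visitsʳ ρ v in suc k , eq

  segment : ∀ {a b} (ρ : Star R a b) {i k} → i ℕ.≤ k → Star R (node ρ i) (node ρ k)
  segment ε       {zero}  {zero}  _       = ε
  segment ε       {zero}  {suc k} _       = ε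
  segment ε       {suc i} {suc k} _       = ε
  segment (_ ◅ ρ) {zero}  {zero}  _       = ε
  segment (r ◅ ρ) {zero}  {suc k} _       = r ◅ segment ρ {zero} {k} z≤n
  segment (_ ◅ ρ) {suc i} {suc k} (s≤s p) = segment ρ p

  suffix : ∀ {a b} (ρ : Star R a b) k → Star R (node ρ k) b
  suffix ρ       zero    = ρ
  suffix ε       (suc k) = ε
  suffix (_ ◅ ρ) (suc k) = suffix ρ k

  peakFrom : ∀ {a b} → (A → ℕ) → ℕ → Star R a b → ℕ
  peakFrom f m ε                 = m
  peakFrom f m (_◅_ {j = b} _ ρ) = peakFrom f (m ℕ.⊔ f b) ρ

  peak : ∀ {a b} → (A → ℕ) → Star R a b → ℕ
  peak {a} f ρ = peakFrom f (f a) ρ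

  ≤-peakFrom : ∀ {a b} f m (ρ : Star R a b) → m ℕ.≤ peakFrom f m ρ
  ≤-peakFrom f m ε       = ℕₚ.≤-refl
  ≤-peakFrom f m (_ ◅ ρ) = ℕₚ.≤-trans (ℕₚ.m≤m⊔n m _) (≤-peakFrom f _ ρ)

  node≤peakFrom : ∀ {a b} f {m} (ρ : Star R a b) → f a ℕ.≤ m → ∀ k → f (node ρ k) ℕ.≤ peakFrom f m ρ
  node≤peakFrom f ρ       fa≤m zero    = ℕₚ.≤-trans fa≤m (≤-peakFrom f _ ρ)
  node≤peakFrom f ε       fa≤m (suc k) = fa≤m
  node≤peakFrom f (_ ◅ ρ) fa≤m (suc k) = node≤peakFrom f ρ (ℕₚ.m≤n⊔m _ _) k

  peakFrom-attained : ∀ {a b} f m (ρ : Star R a b) →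
                      peakFrom f m ρ ≡ m ⊎ ∃ λ k → peakFrom f m ρ ≡ f (node ρ k)
  peakFrom-attained f m ε = inj₁ refl
  peakFrom-attained f m (_ ◅ ρ) with peakFrom-attained f _ ρ
  ... | inj₂ (k , eq) = inj₂ (suc k , eq)
  ... | inj₁ eq with ℕₚ.⊔-sel m (f (node ρ 0))
  ...   | inj₁ m⊔fb≡m  = inj₁ (trans eq m⊔fb≡m)
  ...   | inj₂ m⊔fb≡fb = inj₂ (1 , trans eq m⊔fb≡fb)

  node≤peak : ∀ {a b} f (ρ : Star R a b) k → f (node ρ k) ℕ.≤ peak f ρ
  node≤peak f ρ = node≤peakFrom f ρ ℕₚ.≤-refl

  peak-attained : ∀ {a b} f (ρ : Star R a b) → ∃ λ k → peak f ρ ≡ f (node ρ k)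
  peak-attained f ρ with peakFrom-attained f _ ρ
  ... | inj₁ eq = 0 , eq
  ... | inj₂ at = at

argminFin : ∀ {m} (g : Fin (suc m) → ℕ) → ∃ λ i → ∀ j → g i ℕ.≤ g j
argminFin g = argmin g zero (allFin _) ,
              λ j → All.lookup (f[argmin]≤f[xs] {f = g} zero (allFin _)) (∈-allFin j)

punchIn-fromℕ : ∀ {m} (i : Fin m) → punchIn (fromℕ m) i ≡ inject₁ i
punchIn-fromℕ zero    = refl
punchIn-fromℕ (suc i) = cong suc (punchIn-fromℕ i)

insert-self : ∀ {m n} i j (π : Permutation m n) → insert i j π ⟨$⟩ʳ i ≡ j
insert-self i j π with i ≟ i
... | yes _  = refl
... | no i≢i = contradiction refl i≢i

negPart : ℤ → ℕ
negPart x = ∣ x ⊓ 0ℤ ∣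

negPart-+ : ∀ n → negPart (+ n) ≡ 0
negPart-+ n = cong ∣_∣ (cong +_ (ℕₚ.⊓-zeroʳ n))

clamp-offset : ∀ a D → + ∣ (a + + D) ℤ.⊔ 0ℤ ∣ ≡ a + + (D ℕ.⊔ negPart a)
clamp-offset (+ n) D rewrite ℕₚ.⊔-identityʳ (n ℕ.+ D) | ℕₚ.⊓-zeroʳ n | ℕₚ.⊔-identityʳ D = refl
clamp-offset -[1+ n ] D with D ℕ.≤? n
... | yes D≤n rewrite ℤₚ.⊖-< (s≤s D≤n) | ℕₚ.+-∸-assoc 1 D≤n
        | ℕₚ.m≤n⇒m⊔n≡n (ℕₚ.m≤n⇒m≤1+n D≤n) | ℤₚ.n⊖n≡0 (suc n) = refl
... | no D≰n rewrite ℤₚ.⊖-≥ (ℕₚ.≰⇒> D≰n) | ℕₚ.m≥n⇒m⊔n≡m (ℕₚ.≰⇒> D≰n)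
        | ℤₚ.⊖-≥ (ℕₚ.≰⇒> D≰n) | ℕₚ.⊔-identityʳ (D ℕ.∸ suc n) = refl

monus-offset : ∀ {u} y D z → + u ≡ y + + D → + monus u z ≡ (y + z) + + (D ℕ.⊔ negPart (y + z))
monus-offset {u} y D z u≡y+D = begin
  + ∣ (+ u + z) ℤ.⊔ 0ℤ ∣           ≡⟨ cong (λ x → + ∣ (x + z) ℤ.⊔ 0ℤ ∣) u≡y+D ⟩
  + ∣ (y + + D + z) ℤ.⊔ 0ℤ ∣       ≡⟨ cong (λ x → + ∣ x ℤ.⊔ 0ℤ ∣) (xy∙z≈xz∙y y (+ D) z) ⟩
  + ∣ (y + z + + D) ℤ.⊔ 0ℤ ∣       ≡⟨ clamp-offset (y + z) D ⟩
  (y + z) + + (D ℕ.⊔ negPart (y + z)) ∎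
  where open ≡-Reasoning

module _ {d : ℕ} (V : VASS d) where

  negPartAt : Fin d → ZConf V → ℕ
  negPartAt j c = negPart (proj₂ c j)

  -- the offset between the monus and the ℤ-counters after running along ρ from offset D
  deficit : ∀ {a b} → (Fin d → ℕ) → V ⊢ a →Z* b → Fin d → ℕ
  deficit D ρ j = peakFrom (negPartAt j) (D j) ρ

  monusRun⇒ℤRun : ∀ {p t u w''} y D → (∀ j → + u j ≡ y j + + D j) → V ⊢ (p , u) →M* (t , w'') →
                  ∃ λ w' → Σ (V ⊢ (p , y) →Z* (t , w')) λ ρ → ∀ j → + w'' j ≡ w' j + + deficit D ρ j
  monusRun⇒ℤRun y D u≡y+D ε = y , ε , u≡y+D
  monusRun⇒ℤRun y D u≡y+D (mstep {z = z} _ z∈Δ ◅ run)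
    with monusRun⇒ℤRun (λ j → y j + z j) (λ j → D j ℕ.⊔ negPart (y j + z j))
                       (λ j → monus-offset (y j) (D j) (z j) (u≡y+D j)) run
  ... | w' , ρ , eq = w' , zstep y z∈Δ ◅ ρ , eq

  ℤRun⇒monusRun : ∀ {p t y w'} u D → (∀ j → + u j ≡ y j + + D j) → (ρ : V ⊢ (p , y) →Z* (t , w')) →
                  ∃ λ w'' → V ⊢ (p , u) →M* (t , w'') × ∀ j → + w'' j ≡ w' j + + deficit D ρ j
  ℤRun⇒monusRun u D u≡y+D ε = u , ε , u≡y+D
  ℤRun⇒monusRun u D u≡y+D (zstep {z = z} y z∈Δ ◅ ρ)
    with ℤRun⇒monusRun (λ j → monus (u j) (z j)) (λ j → D j ℕ.⊔ negPart (y j + z j))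
                       (λ j → monus-offset (y j) (D j) (z j) (u≡y+D j)) ρ
  ... | w'' , run , eq = w'' , mstep u z∈Δ ◅ run , eq

  ZChain-resp-≗ : ∀ {s t} n {c c' : Fin n → ZConf V} → (∀ i → c i ≡ c' i) →
                  ZChain V s n c t → ZChain V s n c' t
  ZChain-resp-≗ zero    c≗c' chain       = chain
  ZChain-resp-≗ (suc n) c≗c' (ρ , chain) =
    subst (V ⊢ _ →Z*_) (c≗c' (fromℕ n)) ρ ,
    subst (λ x → ZChain V x n _ _) (c≗c' (fromℕ n)) (ZChain-resp-≗ n (c≗c' ∘ inject₁) chain)

  ZChain⇒run : ∀ {a b} n (c : Fin n → ZConf V) → ZChain V a n c b →
               Σ (V ⊢ a →Z* b) λ ρ → ∀ i → Visits ρ (c i)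
  ZChain⇒run zero    c ρ             = ρ , λ ()
  ZChain⇒run (suc n) c (ρ₁ , chain) with ZChain⇒run n (c ∘ inject₁) chain
  ... | ρ₂ , visits = ρ₁ ◅◅ ρ₂ , λ i → ◅◅-visitsʳ ρ₁ (visit (view i))
    where
    visit : ∀ {i} → View i → Visits ρ₂ (c i)
    visit ‵fromℕ            = 0 , refl
    visit (‵inj₁ {i = i} _) = visits i

  -- Recursively, the earliest of the requested nodes becomes the first link
  -- of the chain, i.e. the one with the largest index.
  sortedChain : ∀ {a b} (ρ : V ⊢ a →Z* b) m (g : Fin m → ℕ) {lo} → (∀ j → lo ℕ.≤ g j) →
                Σ (Permutation′ m) λ σ → Σ (Fin m → ZConf V) λ c →
                  ZChain V (node ρ lo) m c b × (∀ j → c (σ ⟨$⟩ˡ j) ≡ node ρ (g j))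
  sortedChain ρ zero    g {lo} _     = Perm.id , (λ ()) , suffix ρ lo , λ ()
  sortedChain {b = b} ρ (suc m) g {lo} lo≤g with argminFin g
  ... | first , first-min with sortedChain ρ m (g ∘ punchIn first) (first-min ∘ punchIn first)
  ... | σ′ , c′ , chain′ , c′-σ′ = flip τ , c , chain , c-σ
    where
    τ : Permutation′ (suc m)
    τ = insert first (fromℕ m) (flip σ′)

    c : Fin (suc m) → ZConf V
    c = insertAt c′ (fromℕ m) (node ρ (g first))

    c-last : c (fromℕ m) ≡ node ρ (g first)
    c-last = insertAt-lookup c′ (fromℕ m) _

    c′≗c∘inject₁ : ∀ i → c′ i ≡ c (inject₁ i)
    c′≗c∘inject₁ i = trans (sym (insertAt-punchIn c′ (fromℕ m) _ i)) (cong c (punchIn-fromℕ i))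

    chain : ZChain V (node ρ lo) (suc m) c b
    chain = subst (V ⊢ node ρ lo →Z*_) (sym c-last) (segment ρ {lo} {g first} (lo≤g first)) ,
            subst (λ x → ZChain V x m (c ∘ inject₁) b) (sym c-last)
                  (ZChain-resp-≗ m c′≗c∘inject₁ chain′)

    c-σ-cases : ∀ j → Dec (first ≡ j) → c (τ ⟨$⟩ʳ j) ≡ node ρ (g j)
    c-σ-cases j (yes refl)   = trans (cong c (insert-self first (fromℕ m) (flip σ′))) c-last
    c-σ-cases j (no first≢j) = begin
      c (τ ⟨$⟩ʳ j)                             ≡⟨ cong (c ∘ (τ ⟨$⟩ʳ_)) (sym (punchIn-punchOut first≢j)) ⟩
      c (τ ⟨$⟩ʳ punchIn first k)               ≡⟨ cong c (insert-punchIn first (fromℕ m) (flip σ′) k) ⟩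
      c (punchIn (fromℕ m) (σ′ ⟨$⟩ˡ k))        ≡⟨ insertAt-punchIn c′ (fromℕ m) _ _ ⟩
      c′ (σ′ ⟨$⟩ˡ k)                           ≡⟨ c′-σ′ k ⟩
      node ρ (g (punchIn first k))             ≡⟨ cong (node ρ ∘ g) (punchIn-punchOut first≢j) ⟩
      node ρ (g j)                             ∎
      where
      open ≡-Reasoning
      k = punchOut first≢j

    c-σ : ∀ j → c (τ ⟨$⟩ʳ j) ≡ node ρ (g j)
    c-σ j = c-σ-cases j (first ≟ j)

  peakChain : ∀ {a b} (ρ : V ⊢ a →Z* b) →
              Σ (Permutation′ d) λ σ → Σ (Fin d → ZConf V) λ c →
                ZChain V a d c b × (∀ j → negPartAt j (c (σ ⟨$⟩ˡ j)) ≡ peak (negPartAt j) ρ)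
  peakChain ρ with sortedChain ρ d (λ j → proj₁ (peak-attained (negPartAt j) ρ)) (λ _ → z≤n)
  ... | σ , c , chain , c-σ = σ , c , chain ,
    λ j → trans (cong (negPartAt j) (c-σ j)) (sym (proj₂ (peak-attained (negPartAt j) ρ)))

  module _ (s t : Fin (states V)) (v : Fin d → ℕ) where

    source-offset : ∀ j → + v j ≡ toℤ v j + + negPart (toℤ v j)
    source-offset j = begin
      + v j                         ≡⟨ sym (ℤₚ.+-identityʳ (+ v j)) ⟩
      + v j + 0ℤ                    ≡⟨ cong (λ x → + v j + + x) (sym (negPart-+ (v j))) ⟩
      + v j + + negPart (+ v j)     ∎
      where open ≡-Reasoning

    monusReach⇒ZChain : ∀ {w''} → V ⊢ (s , v) →M* (t , w'') →
      Σ (Permutation′ d) λ σ → Σ (Fin d → ZConf V) λ c → Σ (Fin d → ℤ) λ w' →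
        ZChain V (s , toℤ v) d c (t , w') ×
        (∀ j → w' j + + negPartAt j (c (σ ⟨$⟩ˡ j)) ≡ + w'' j)
    monusReach⇒ZChain run with monusRun⇒ℤRun (toℤ v) (negPart ∘ toℤ v) source-offset run
    ... | w' , ρ , w''≡w'+peak with peakChain ρ
    ... | σ , c , chain , c-peak = σ , c , w' , chain ,
      λ j → trans (cong (λ x → w' j + + x) (c-peak j)) (sym (w''≡w'+peak j))

    ZChain⇒monusReach : ∀ {c w'} → ZChain V (s , toℤ v) d c (t , w') →
      ∃ λ w'' → V ⊢ (s , v) →M* (t , w'') × ∀ i j → w' j + + negPartAt j (c i) ℤ.≤ + w'' j
    ZChain⇒monusReach {c} {w'} chain with ZChain⇒run d c chain
    ... | ρ , visits with ℤRun⇒monusRun v (negPart ∘ toℤ v) source-offset ρ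
    ... | w'' , run , w''≡w'+peak = w'' , run , λ i j → bound i j (visits i)
      where
      bound : ∀ i j → Visits ρ (c i) → w' j + + negPartAt j (c i) ℤ.≤ + w'' j
      bound i j (k , node≡c) = subst (λ x → w' j + + negPartAt j x ℤ.≤ + w'' j) node≡c
        (ℤₚ.≤-trans (ℤₚ.+-monoʳ-≤ (w' j) (ℤ.+≤+ (node≤peak (negPartAt j) ρ k)))
                    (ℤₚ.≤-reflexive (sym (w''≡w'+peak j))))

proposition10 : ∀ {d : ℕ} (V : VASS d) (s t : Fin (states V)) (v w : Fin d → ℕ) →
    (∃ λ (w'' : Fin d → ℕ) → ((j : Fin d) → w'' j Data.Nat.≥ w j) × (V ⊢ (s , v) →M* (t , w'')))
    ⇔
    (Σ (Permutation′ d) λ σ → Σ (Fin d → ZConf V) λ c → Σ (Fin d → ℤ) λ w' →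
      ZChain V (s , toℤ v) d c (t , w')
      × ((j : Fin d) → w' j + + ∣ proj₂ (c (σ ⟨$⟩ˡ j)) j ⊓ 0ℤ ∣ ≥ + w j))
proposition10 V s t v w = mk⇔
  (λ (w'' , w≤w'' , run) →
    let σ , c , w' , chain , eq = monusReach⇒ZChain V s t v run
    in  σ , c , w' , chain , λ j → ℤₚ.≤-trans (ℤ.+≤+ (w≤w'' j)) (ℤₚ.≤-reflexive (sym (eq j))))
  (λ (σ , c , w' , chain , w≤) →
    let w'' , run , bound = ZChain⇒monusReach V s t v chain
    in  w'' , (λ j → ℤₚ.drop‿+≤+ (ℤₚ.≤-trans (w≤ j) (bound (σ ⟨$⟩ˡ j) j))) , run)
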